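{- Let $L$ be a three-dimensional lattice, $f : L \to L$, and $s = (*,*,s_3)$ a principal slice. If $(a, u)$ is an up set witness, then one of the following exists: (1) a point $c$ with $a \preceq c \preceq u$ and $c \in \mathrm{Down}(f)$; (2) two points $x, y$ with $a \preceq x \preceq y \preceq u$ that witness a violation of order preservation of $f$; (3) a point $c$ with $a \preceq c \preceq u$ and $c \in \mathrm{Up}(f_s)$.
   Context: $L = L(n_1,n_2,n_3)$ is the set of $x \in \mathbb{N}^3$ with $1 \le x_i \le n_i$, ordered by $x \preceq y$ iff $x_i \le y_i$ for all $i$. $\mathrm{Up}(f)=\{x : x \preceq f(x)\}$, $\mathrm{Down}(f)=\{x : f(x)\preceq x\}$. $L_s = \{x \in L : x_3 = s_3\}$, and $f_s : L_s \to L_s$ is given by $f_s(x)_i = f(x)_i$ for $i\in\{1,2\}$ and $f_s(x)_3 = s_3$; $\mathrm{Up}(f_s) = \{x \in L_s : x \preceq f_s(x)\}$. Points $x,y$ witness a violation of order preservation of $f$ if $x \preceq y$ and $f(x)\not\preceq f(y)$. An up set witness is a pair $(a,u)$ with $a, u \in L_s$ such that $a_3 \ge f(a)_3$ and $u_3 \ge f(u)_3$, and there exist $i, j \in \{1,2\}$ with $i \ne j$ such that $a_i = u_i$, $u_j \ge a_j$, $u_j \ge f(u)_j$ and $f(a)_j \ge a_j$. -}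

module Defs where

open import Data.Nat using (ℕ; _≤_; _≥_)
open import Data.Fin using (Fin; zero; suc)
open import Data.Product using (Σ; ∃; _×_; _,_; proj₁)
open import Relation.Binary.PropositionalEquality using (_≡_; _≢_)
open import Relation.Nullary using (¬_)

-- Points of ℕ³: coordinates indexed by Fin 3 (index 0 = x₁, 1 = x₂, 2 = x₃).
Pt : Set
Pt = Fin 3 → ℕ

InL : Pt → Pt → Set
InL n x = ∀ i → 1 ≤ x i × x i ≤ n i

L : Pt → Set
L n = Σ Pt (InL n)

three : Fin 3
three = suc (suc zero)

-- the two in-slice coordinates {1,2} are embedded into Fin 3
emb : Fin 2 → Fin 3
emb zero = zero
emb (suc zero) = suc zero

_≼_ : Pt → Pt → Set
x ≼ y = ∀ i → x i ≤ y i

_⪯_ : {n : Pt} → L n → L n → Set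
x ⪯ y = proj₁ x ≼ proj₁ y

module _ {n : Pt} (f : L n → L n) where

  F : L n → Pt
  F x = proj₁ (f x)

  Up : L n → Set
  Up x = proj₁ x ≼ F x

  Down : L n → Set
  Down x = F x ≼ proj₁ x

  InSlice : ℕ → L n → Set
  InSlice s₃ x = proj₁ x three ≡ s₃

  fs : ℕ → L n → Pt
  fs s₃ x zero = F x zero
  fs s₃ x (suc zero) = F x (suc zero)
  fs s₃ x (suc (suc zero)) = s₃

  UpSlice : ℕ → L n → Set
  UpSlice s₃ x = InSlice s₃ x × (proj₁ x ≼ fs s₃ x)

  Violation : L n → L n → Set
  Violation x y = x ⪯ y × ¬ (F x ≼ F y)

  UpSetWitness : ℕ → L n → L n → Set
  UpSetWitness s₃ a u =
    InSlice s₃ a × InSlice s₃ u ×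
    proj₁ a three ≥ F a three × proj₁ u three ≥ F u three ×
    Σ (Fin 2) λ i → Σ (Fin 2) λ j →
      i ≢ j × proj₁ a (emb i) ≡ proj₁ u (emb i) ×
      proj₁ u (emb j) ≥ proj₁ a (emb j) ×
      proj₁ u (emb j) ≥ F u (emb j) ×
      F a (emb j) ≥ proj₁ a (emb j)

module Submission where

-- Walk from a towards u along the in-slice coordinate j, the only coordinate in which
-- a and u differ, and watch φ(k) = f(walk k)ⱼ.  It starts at or above the walk,
-- so (discrete intermediate value theorem) either f fixes coordinate j at some walk point,
-- or φ drops between consecutive walk points (a violation), or φ ends above uⱼ ≥ f(u)ⱼ
-- (a violation with u).  At a fixed point c, either f(c)₃ > s₃ ≥ f(u)₃, a violation with u
-- again, or the remaining in-slice coordinate puts c in Down(f) or in Up(f_s).  Of the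
-- hypotheses on the third coordinate only u₃ ≥ f(u)₃ is needed.

open import Defs
open import Data.Nat using (ℕ; zero; suc; _+_; _∸_; _⊓_; _≤_; _<_; z≤n)
open import Data.Nat.Properties
open import Data.Fin using (Fin) renaming (zero to fzero; suc to fsuc)
open import Data.Fin.Properties using () renaming (_≟_ to _≟ᶠ_)
open import Data.Product using (Σ; ∃-syntax; _×_; _,_; proj₁; proj₂)
open import Data.Sum using (_⊎_; inj₁; inj₂)
open import Data.Vec.Functional using (updateAt)
open import Data.Vec.Functional.Properties using (updateAt-updates; updateAt-minimal)
open import Relation.Binary.Definitions using (tri<; tri≈; tri>)
open import Relation.Nullary using (yes; no; contradiction)
open import Relation.Binary.PropositionalEquality

crossing : ∀ (φ : ℕ → ℕ) {lo} → lo ≤ φ 0 → ∀ d →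
    (∃[ k ] k ≤ d × φ k ≡ k + lo)
  ⊎ (∃[ k ] k < d × φ (suc k) < φ k)
  ⊎ d + lo < φ d
crossing φ lo≤φ0 zero with m≤n⇒m<n∨m≡n lo≤φ0
... | inj₁ lo<φ0 = inj₂ (inj₂ lo<φ0)
... | inj₂ lo≡φ0 = inj₁ (0 , z≤n , sym lo≡φ0)
crossing φ {lo} lo≤φ0 (suc d) with crossing φ lo≤φ0 d
... | inj₁ (k , k≤d , fixed) = inj₁ (k , m≤n⇒m≤1+n k≤d , fixed)
... | inj₂ (inj₁ (k , k<d , descent)) = inj₂ (inj₁ (k , m<n⇒m<1+n k<d , descent))
... | inj₂ (inj₂ overshoot) with <-cmp (φ (suc d)) (suc d + lo)
...   | tri< below _ _ = inj₂ (inj₁ (d , n<1+n d , <-≤-trans below overshoot))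
...   | tri≈ _ fixed _ = inj₁ (suc d , ≤-refl , fixed)
...   | tri> _ _ above = inj₂ (inj₂ above)

updateAt-pointwise : ∀ {m} (P : Fin m → ℕ → Set) (x : Fin m → ℕ) (J : Fin m) {v : ℕ} →
  P J v → (∀ t → t ≢ J → P t (x t)) → ∀ t → P t (updateAt x J (λ _ → v) t)
updateAt-pointwise P x J pJ pOther t with t ≟ᶠ J
... | yes refl = subst (P J) (sym (updateAt-updates J x)) pJ
... | no t≢J = subst (P t) (sym (updateAt-minimal t J x t≢J)) (pOther t t≢J)

module Walk {n : Pt} (a u : L n) (a⪯u : a ⪯ u) (J : Fin 3) where

  lo hi : ℕ
  lo = proj₁ a J
  hi = proj₁ u J

  moved : ℕ → Pt
  moved m = updateAt (proj₁ a) J (λ _ → m ⊓ hi)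

  moved-J : ∀ m → moved m J ≡ m ⊓ hi
  moved-J m = updateAt-updates J (proj₁ a)

  moved-other : ∀ m t → t ≢ J → moved m t ≡ proj₁ a t
  moved-other m t t≢J = updateAt-minimal t J (proj₁ a) t≢J

  a≼moved : ∀ {m} → lo ≤ m → proj₁ a ≼ moved m
  a≼moved lo≤m = updateAt-pointwise (λ t v → proj₁ a t ≤ v) (proj₁ a) J
    (⊓-glb lo≤m (a⪯u J)) (λ _ _ → ≤-refl)

  moved≼u : ∀ m → moved m ≼ proj₁ u
  moved≼u m = updateAt-pointwise (λ t v → v ≤ proj₁ u t) (proj₁ a) J (m⊓n≤n m hi) (λ t _ → a⪯u t)

  moved-mono : ∀ {m m′} → lo ≤ m′ → m ≤ m′ → moved m ≼ moved m′
  moved-mono {m} {m′} lo≤m′ m≤m′ = updateAt-pointwise (λ t v → v ≤ moved m′ t) (proj₁ a) J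
    (subst (m ⊓ hi ≤_) (sym (moved-J m′)) (⊓-monoˡ-≤ hi m≤m′))
    (λ t _ → a≼moved lo≤m′ t)

  moved-InL : ∀ {m} → lo ≤ m → InL n (moved m)
  moved-InL lo≤m t =
    ≤-trans (proj₁ (proj₂ a t)) (a≼moved lo≤m t) , ≤-trans (moved≼u _ t) (proj₂ (proj₂ u t))

  -- walk 0 is a itself, not a pointwise copy: without function extensionality f need not
  -- agree on the two, and the walk must start where a ≤ f(a) in coordinate J is known.
  walk : ℕ → L n
  walk zero = a
  walk (suc k) = moved (suc k + lo) , moved-InL (m≤n+m lo (suc k))

  a⪯walk : ∀ k → a ⪯ walk k
  a⪯walk zero t = ≤-refl
  a⪯walk (suc k) = a≼moved (m≤n+m lo (suc k))

  walk⪯u : ∀ k → walk k ⪯ u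
  walk⪯u zero = a⪯u
  walk⪯u (suc k) = moved≼u (suc k + lo)

  walk-mono : ∀ k → walk k ⪯ walk (suc k)
  walk-mono zero = a⪯walk 1
  walk-mono (suc k) = moved-mono (m≤n+m lo (2 + k)) (n≤1+n (suc k + lo))

  walk-J : ∀ k → k + lo ≤ hi → proj₁ (walk k) J ≡ k + lo
  walk-J zero _ = refl
  walk-J (suc k) in-range = trans (moved-J (suc k + lo)) (m≤n⇒m⊓n≡m in-range)

  walk-other : ∀ k t → t ≢ J → proj₁ (walk k) t ≡ proj₁ a t
  walk-other zero t _ = refl
  walk-other (suc k) t t≢J = moved-other (suc k + lo) t t≢J

emb≢three : ∀ j → emb j ≢ three
emb≢three fzero ()
emb≢three (fsuc fzero) ()

module _ {n : Pt} (f : L n → L n) where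

  Outcome : ℕ → L n → L n → Set
  Outcome s₃ a u =
      (Σ (L n) λ c → a ⪯ c × c ⪯ u × Down f c)
    ⊎ (Σ (L n) λ x → Σ (L n) λ y → a ⪯ x × x ⪯ y × y ⪯ u × Violation f x y)
    ⊎ (Σ (L n) λ c → a ⪯ c × c ⪯ u × UpSlice f s₃ c)

  violation-at : ∀ {x y} → x ⪯ y → ∀ t → F f y t < F f x t → Violation f x y
  violation-at x⪯y t fy<fx = x⪯y , λ fx≼fy → <⇒≱ fy<fx (fx≼fy t)

  upSetWitness⇒⪯ : ∀ {s₃ a u} → UpSetWitness f s₃ a u → a ⪯ u
  upSetWitness⇒⪯ (_ , _ , _ , _ , fzero , fzero , i≢j , _) = contradiction refl i≢j
  upSetWitness⇒⪯ (a₃ , u₃ , _ , _ , fzero , fsuc fzero , _ , a₁≡u₁ , a₂≤u₂ , _) =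
    λ { fzero → ≤-reflexive a₁≡u₁
      ; (fsuc fzero) → a₂≤u₂
      ; (fsuc (fsuc fzero)) → ≤-reflexive (trans a₃ (sym u₃)) }
  upSetWitness⇒⪯ (a₃ , u₃ , _ , _ , fsuc fzero , fzero , _ , a₂≡u₂ , a₁≤u₁ , _) =
    λ { fzero → a₁≤u₁
      ; (fsuc fzero) → ≤-reflexive a₂≡u₂
      ; (fsuc (fsuc fzero)) → ≤-reflexive (trans a₃ (sym u₃)) }
  upSetWitness⇒⪯ (_ , _ , _ , _ , fsuc fzero , fsuc fzero , i≢j , _) = contradiction refl i≢j

  fixed⇒Down⊎UpSlice : ∀ {s₃} (j : Fin 2) (c : L n) → proj₁ c three ≡ s₃ → F f c three ≤ s₃ →
    F f c (emb j) ≡ proj₁ c (emb j) → Down f c ⊎ UpSlice f s₃ c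
  fixed⇒Down⊎UpSlice fzero c c₃ fc₃≤s₃ fixed
    with ≤-total (proj₁ c (fsuc fzero)) (F f c (fsuc fzero))
  ... | inj₁ up = inj₂ (c₃ , λ { fzero → ≤-reflexive (sym fixed)
                                ; (fsuc fzero) → up
                                ; (fsuc (fsuc fzero)) → ≤-reflexive c₃ })
  ... | inj₂ down = inj₁ λ { fzero → ≤-reflexive fixed
                            ; (fsuc fzero) → down
                            ; (fsuc (fsuc fzero)) → subst (F f c three ≤_) (sym c₃) fc₃≤s₃ }
  fixed⇒Down⊎UpSlice (fsuc fzero) c c₃ fc₃≤s₃ fixed
    with ≤-total (proj₁ c fzero) (F f c fzero)
  ... | inj₁ up = inj₂ (c₃ , λ { fzero → up
                                ; (fsuc fzero) → ≤-reflexive (sym fixed)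
                                ; (fsuc (fsuc fzero)) → ≤-reflexive c₃ })
  ... | inj₂ down = inj₁ λ { fzero → down
                            ; (fsuc fzero) → ≤-reflexive fixed
                            ; (fsuc (fsuc fzero)) → subst (F f c three ≤_) (sym c₃) fc₃≤s₃ }

  module _ {s₃ : ℕ} (a u : L n) (a⪯u : a ⪯ u) (j : Fin 2)
    (a₃≡s₃ : proj₁ a three ≡ s₃) (fu₃≤s₃ : F f u three ≤ s₃) where

    open Walk a u a⪯u (emb j)

    d : ℕ
    d = hi ∸ lo

    u⪯u : u ⪯ u
    u⪯u _ = ≤-refl

    outcome-at-fixed-point : ∀ k → k ≤ d → F f (walk k) (emb j) ≡ k + lo → Outcome s₃ a u
    outcome-at-fixed-point k k≤d fixed with F f (walk k) three ≤? s₃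
    ... | no fc₃≰s₃ = inj₂ (inj₁ (walk k , u , a⪯walk k , walk⪯u k , u⪯u ,
            violation-at (walk⪯u k) three (≤-<-trans fu₃≤s₃ (≰⇒> fc₃≰s₃))))
    ... | yes fc₃≤s₃
      with fixed⇒Down⊎UpSlice j (walk k) c₃≡s₃ fc₃≤s₃ (trans fixed (sym cⱼ))
      where
        c₃≡s₃ : proj₁ (walk k) three ≡ s₃
        c₃≡s₃ = trans (walk-other k three (≢-sym (emb≢three j))) a₃≡s₃
        cⱼ : proj₁ (walk k) (emb j) ≡ k + lo
        cⱼ = walk-J k (≤-trans (+-monoˡ-≤ lo k≤d) (≤-reflexive (m∸n+n≡m (a⪯u (emb j)))))
    ...   | inj₁ down = inj₁ (walk k , a⪯walk k , walk⪯u k , down)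
    ...   | inj₂ up = inj₂ (inj₂ (walk k , a⪯walk k , walk⪯u k , up))

    walk-outcome : F f u (emb j) ≤ hi → lo ≤ F f a (emb j) → Outcome s₃ a u
    walk-outcome fuⱼ≤uⱼ aⱼ≤faⱼ with crossing (λ k → F f (walk k) (emb j)) aⱼ≤faⱼ d
    ... | inj₁ (k , k≤d , fixed) = outcome-at-fixed-point k k≤d fixed
    ... | inj₂ (inj₁ (k , _ , descent)) = inj₂ (inj₁ (walk k , walk (suc k) , a⪯walk k ,
            walk-mono k , walk⪯u (suc k) , violation-at (walk-mono k) (emb j) descent))
    ... | inj₂ (inj₂ overshoot) = inj₂ (inj₁ (walk d , u , a⪯walk d , walk⪯u d , u⪯u ,
            violation-at (walk⪯u d) (emb j)
              (≤-<-trans fuⱼ≤uⱼ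
                (subst (_< F f (walk d) (emb j)) (m∸n+n≡m (a⪯u (emb j))) overshoot))))

lemma9 : (n : Pt) (f : L n → L n) (s₃ : ℕ) → 1 ≤ s₃ → s₃ ≤ n three →
    (a u : L n) → UpSetWitness f s₃ a u →
    (Σ (L n) λ c → a ⪯ c × c ⪯ u × Down f c)
    ⊎ (Σ (L n) λ x → Σ (L n) λ y →
         a ⪯ x × x ⪯ y × y ⪯ u × Violation f x y)
    ⊎ (Σ (L n) λ c → a ⪯ c × c ⪯ u × UpSlice f s₃ c)
lemma9 n f s₃ _ _ a u w@(a₃≡s₃ , u₃≡s₃ , _ , fu₃≤u₃ , _ , j , _ , _ , _ , fuⱼ≤uⱼ , aⱼ≤faⱼ) =
  walk-outcome f a u (upSetWitness⇒⪯ f w) j a₃≡s₃ fu₃≤s₃ fuⱼ≤uⱼ aⱼ≤faⱼ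
  where
    fu₃≤s₃ : F f u three ≤ s₃
    fu₃≤s₃ = ≤-trans fu₃≤u₃ (≤-reflexive u₃≡s₃)
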